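{- Let $P[1\mathinner{.\,.} m]$ be a string that has a CT-block-period $p\in[1,\lfloor m/2\rfloor)$ and such that $P[1]$ is the leftmost minimum of $P[1\mathinner{.\,.} m-p]$. For $i\in[1,m/p]$ let $c_i=(i-1)p+1$. Then for all $i\in[1,m/p]$, $P[c_i]$ is the leftmost minimum of $P[c_i\mathinner{.\,.} m]$.
   Context: Strings are over a totally ordered alphabet; $P[i]$ is the $i$-th character (1-indexed), $P[i\mathinner{.\,.} j]$ denotes $P[i]\cdots P[j]$. The leftmost minimum of a nonempty string $X$ is $X[j]$ for the smallest index $j$ at which the minimum value occurs. The Cartesian tree $\mathsf{CT}(X)$: empty for the empty string; otherwise a root with left subtree $\mathsf{CT}(X[1\mathinner{.\,.} j-1])$ and right subtree $\mathsf{CT}(X[j+1\mathinner{.\,.} |X|])$, where $X[j]$ is the leftmost minimum. $X\approx Y$ iff $\mathsf{CT}(X)=\mathsf{CT}(Y)$. A string $S[1\mathinner{.\,.} \ell]$ has CT-border-period $p\in[1,\ell]$ iff $S[1\mathinner{.\,.} \ell-p]\approx S[p+1\mathinner{.\,.} \ell]$; it has CT-block-period $p$ iff $p$ divides $\ell$, $p$ is a CT-border-period of $S$, and the leftmost minimum of $S$ is $S[1]$ or $S[\ell]$. -}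

module Defs where

open import Level using (Level; _⊔_)
open import Data.Nat using (ℕ; suc; _+_; _∸_)
open import Data.List using (List; []; _∷_; _++_; length; take; drop)
open import Data.List.Relation.Unary.All using (All)
open import Data.Product using (∃; _×_)
open import Relation.Binary.PropositionalEquality using (_≡_)
open import Relation.Binary.Bundles using (StrictTotalOrder)
open import Relation.Nullary using (¬_)

module Strings {a ℓ₁ ℓ₂ : Level} (O : StrictTotalOrder a ℓ₁ ℓ₂) where
  open StrictTotalOrder O renaming (Carrier to A)

  String : Set a
  String = List A

  -- S[i .. j] (1-indexed, inclusive); empty when j < i.
  _[_⋯_] : String → ℕ → ℕ → String
  S [ i ⋯ j ] = take (suc j ∸ i) (drop (i ∸ 1) S)

  LeftmostMinAt : String → ℕ → Set (a ⊔ ℓ₂)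
  LeftmostMinAt X j =
    ∃ λ L → ∃ λ x → ∃ λ R →
      (X ≡ L ++ x ∷ R) × (suc (length L) ≡ j) ×
      All (λ y → x < y) L × All (λ y → ¬ (y < x)) R

  data Tree : Set where
    leaf : Tree
    node : Tree → Tree → Tree

  data IsCT : String → Tree → Set (a ⊔ ℓ₂) where
    ct-empty : IsCT [] leaf
    ct-node  : ∀ {L x R l r} →
               LeftmostMinAt (L ++ x ∷ R) (suc (length L)) →
               IsCT L l → IsCT R r → IsCT (L ++ x ∷ R) (node l r)

  _≈CT_ : String → String → Set (a ⊔ ℓ₂)
  X ≈CT Y = ∃ λ t → IsCT X t × IsCT Y t

  -- p is a CT-border-period of S[1..ℓ] (ℓ = |S|), requires p ∈ [1, ℓ]
  -- (the range condition is stated separately where used)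
  CTBorderPeriod : String → ℕ → Set (a ⊔ ℓ₂)
  CTBorderPeriod S p = (S [ 1 ⋯ length S ∸ p ]) ≈CT (S [ p + 1 ⋯ length S ])

{-# OPTIONS --safe #-}
module Submission where

-- Call k a suffix minimum of X when X[k+1] is the leftmost minimum of X[k+1 ..]. Suffix minima are
-- an invariant of the Cartesian tree, so the CT-border P[1 .. m-p] ≈ P[p+1 .. m] turns a suffix
-- minimum k < m - p of P into the suffix minimum p + k. Position 0 is one: were P[m] the leftmost
-- minimum of P, the border applied to the hypothesis on P[1 .. m-p] would give P[p+1] ≤ P[m] with
-- p + 1 < m. Induction then reaches every block start (i - 1) p.

open import Defs
open import Level using (Level; _⊔_)
open import Data.Nat using (ℕ; zero; suc; _+_; _*_; _∸_; _≤_; _<_; s≤s; _/_; NonZero; >-nonZero⁻¹)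
open import Data.Nat.Properties
  using ( +-identityʳ; +-comm; m≤m+n; m≤n+m; m<n+m; m≤m*n; *-monoˡ-≤; ∸-monoˡ-<; m+n∸m≡n; m+n∸n≡m
        ; <-cmp; ≤-reflexive; ≤-trans; <-≤-trans; ≤-<-trans)
open import Data.Nat.DivMod using (m/n*n≤m)
open import Data.Nat.Divisibility using (_∣_)
open import Data.List using (List; []; _∷_; _++_; length; take; drop)
open import Data.List.Properties using (length-++; take-all; length-drop; drop-drop)
open import Data.List.Relation.Unary.All using (All; []; _∷_; head)
open import Data.List.Relation.Unary.All.Properties using (++⁻ʳ; take⁺)
open import Data.Sum using (_⊎_; inj₁; inj₂)
open import Data.Product using (_×_; _,_)
open import Data.Empty.Polymorphic using (⊥)
open import Relation.Nullary using (¬_; contradiction)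
open import Relation.Binary.Bundles using (StrictTotalOrder)
open import Relation.Binary.Definitions using (tri<; tri≈; tri>)
open import Relation.Binary.PropositionalEquality using (_≡_; refl; sym; trans; cong; cong₂; subst)

drop-length-++ : ∀ {a} {A : Set a} (L M : List A) → drop (length L) (L ++ M) ≡ M
drop-length-++ []      M = refl
drop-length-++ (_ ∷ L) M = drop-length-++ L M

drop-++-∷ : ∀ {a} {A : Set a} (L : List A) {x : A} (M : List A) {k : ℕ} →
            length L < k → drop k (L ++ x ∷ M) ≡ drop (k ∸ suc (length L)) M
drop-++-∷ []      M {suc k} _         = refl
drop-++-∷ (_ ∷ L) M {suc k} (s≤s L<k) = drop-++-∷ L M L<k

module SuffixMinima {a ℓ₁ ℓ₂ : Level} (O : StrictTotalOrder a ℓ₁ ℓ₂) where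
  open StrictTotalOrder O using () renaming (Carrier to A; _<_ to _≺_)
  open Strings O

  HeadIsMin : String → Set (a ⊔ ℓ₂)
  HeadIsMin []      = ⊥
  HeadIsMin (h ∷ R) = All (λ y → ¬ (y ≺ h)) R

  -- k is 0-indexed, unlike the position in LeftmostMinAt.
  SuffixMinAt : String → ℕ → Set (a ⊔ ℓ₂)
  SuffixMinAt X k = HeadIsMin (drop k X)

  leftmostMinAt-1⇒headIsMin : ∀ {X} → LeftmostMinAt X 1 → HeadIsMin X
  leftmostMinAt-1⇒headIsMin ([] , x , R , refl , refl , [] , R≥x) = R≥x

  headIsMin⇒leftmostMinAt-1 : ∀ {X} → HeadIsMin X → LeftmostMinAt X 1
  headIsMin⇒leftmostMinAt-1 {h ∷ R} R≥h = [] , h , R , refl , refl , [] , R≥h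

  headIsMin-take : ∀ n X → HeadIsMin X → HeadIsMin (take (suc n) X)
  headIsMin-take n (h ∷ R) R≥h = take⁺ n R≥h

  suffixMinAt-take : ∀ {j n} X → j < n → SuffixMinAt X j → SuffixMinAt (take n X) j
  suffixMinAt-take {zero}  {suc n} X       _         = headIsMin-take n X
  suffixMinAt-take {suc j} {suc n} (_ ∷ X) (s≤s j<n) = suffixMinAt-take X j<n

  leftmostMinAt⇒suffixMinAt : ∀ {X j} → LeftmostMinAt X (suc j) → SuffixMinAt X j
  leftmostMinAt⇒suffixMinAt (L , x , R , refl , refl , _ , R≥x) =
    subst HeadIsMin (sym (drop-length-++ L (x ∷ R))) R≥x

  ¬suffixMinAt-before-leftmostMin : ∀ {X j k} → LeftmostMinAt X j → suc k < j → ¬ SuffixMinAt X k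
  ¬suffixMinAt-before-leftmostMin (L , x , R , refl , refl , L>x , _) (s≤s k<|L|) =
    go L L>x k<|L|
    where
      go : ∀ L {k} → All (x ≺_) L → k < length L → ¬ SuffixMinAt (L ++ x ∷ R) k
      go (h ∷ L) {zero}  (x<h ∷ _) _         rest≥h = contradiction x<h (head (++⁻ʳ L rest≥h))
      go (_ ∷ L) {suc k} (_ ∷ L>x) (s≤s k<L) = go L L>x k<L

  size : Tree → ℕ
  size leaf       = 0
  size (node l r) = size l + suc (size r)

  length-IsCT : ∀ {X t} → IsCT X t → length X ≡ size t
  length-IsCT ct-empty = refl
  length-IsCT (ct-node {L} _ ctL ctR) =
    trans (length-++ L) (cong₂ (λ m n → m + suc n) (length-IsCT ctL) (length-IsCT ctR))

  -- Both strings split at the root at the same position (their left parts have equal sizes); a suffix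
  -- minimum is never left of the root, and right of it it is a suffix minimum of the right part.
  suffixMinAt-IsCT : ∀ {X Y t} k → IsCT X t → IsCT Y t → SuffixMinAt X k → SuffixMinAt Y k
  suffixMinAt-IsCT zero    ct-empty ct-empty ()
  suffixMinAt-IsCT (suc _) ct-empty ct-empty ()
  suffixMinAt-IsCT k (ct-node {L} {_} {R} minX ctL ctR) (ct-node {L'} {y} {R'} minY ctL' ctR') X[k]
    with <-cmp k (length L)
  ... | tri< k<|L| _ _ = contradiction X[k] (¬suffixMinAt-before-leftmostMin minX (s≤s k<|L|))
  ... | tri≈ _ refl _  = subst (SuffixMinAt (L' ++ y ∷ R')) |L'|≡|L| (leftmostMinAt⇒suffixMinAt minY)
    where
      |L'|≡|L| : length L' ≡ length L
      |L'|≡|L| = trans (length-IsCT ctL') (sym (length-IsCT ctL))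
  ... | tri> _ _ |L|<k =
    subst HeadIsMin (sym (drop-++-∷ L' R' |L'|<k))
      (subst (SuffixMinAt R') (cong (λ n → k ∸ suc n) |L|≡|L'|)
        (suffixMinAt-IsCT (k ∸ suc (length L)) ctR ctR' R[j]))
    where
      |L|≡|L'| : length L ≡ length L'
      |L|≡|L'| = trans (length-IsCT ctL) (sym (length-IsCT ctL'))
      |L'|<k : length L' < k
      |L'|<k = subst (_< k) |L|≡|L'| |L|<k
      R[j] : SuffixMinAt R (k ∸ suc (length L))
      R[j] = subst HeadIsMin (drop-++-∷ L R |L|<k) X[k]

  suffixMinAt-resp-≈CT : ∀ {X Y} k → X ≈CT Y → SuffixMinAt X k → SuffixMinAt Y k
  suffixMinAt-resp-≈CT k (_ , ctX , ctY) = suffixMinAt-IsCT k ctX ctY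

  suffix-slice≡drop : ∀ P c → P [ c + 1 ⋯ length P ] ≡ drop c P
  suffix-slice≡drop P c rewrite m+n∸n≡m c 1 | +-comm c 1 =
    take-all (length P ∸ c) (drop c P) (≤-reflexive (length-drop c P))

  module _ (P : String) (p : ℕ) (border : CTBorderPeriod P p) where

    suffixMinAt-shift : ∀ k → SuffixMinAt (P [ 1 ⋯ length P ∸ p ]) k → SuffixMinAt P (p + k)
    suffixMinAt-shift k prefix[k] =
      subst HeadIsMin (drop-drop p k P)
        (subst (λ Z → SuffixMinAt Z k) (suffix-slice≡drop P p) (suffixMinAt-resp-≈CT k border prefix[k]))

    suffixMinAt-multiples : HeadIsMin P → ∀ k → k * p < length P → SuffixMinAt P (k * p)
    suffixMinAt-multiples P[1] zero    _      = P[1]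
    suffixMinAt-multiples P[1] (suc k) p+kp<m =
      suffixMinAt-shift (k * p) (suffixMinAt-take P kp<m∸p (suffixMinAt-multiples P[1] k kp<m))
      where
        kp<m : k * p < length P
        kp<m = ≤-<-trans (m≤n+m (k * p) p) p+kp<m
        kp<m∸p : k * p < length P ∸ p
        kp<m∸p = subst (_< length P ∸ p) (m+n∸m≡n p (k * p)) (∸-monoˡ-< p+kp<m (m≤m+n p (k * p)))

    headIsMin-of-ctBlockPeriod : suc p < length P → LeftmostMinAt (P [ 1 ⋯ length P ∸ p ]) 1 →
                                 LeftmostMinAt P 1 ⊎ LeftmostMinAt P (length P) → HeadIsMin P
    headIsMin-of-ctBlockPeriod _ _ (inj₁ P[1]) = leftmostMinAt-1⇒headIsMin P[1]
    headIsMin-of-ctBlockPeriod p+1<m prefix[1] (inj₂ P[m]) =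
      contradiction (suffixMinAt-shift 0 (leftmostMinAt-1⇒headIsMin prefix[1]))
        (¬suffixMinAt-before-leftmostMin P[m] (subst (λ n → suc n < length P) (sym (+-identityʳ p)) p+1<m))

lemma15 : ∀ {a ℓ₁ ℓ₂ : Level} (O : StrictTotalOrder a ℓ₁ ℓ₂) →
    let open Strings O in
    (P : String) (p : ℕ) → .{{_ : NonZero p}} →
    p < length P / 2 →
    -- p is a CT-block-period of P = P[1..m]
    (p ∣ length P × p ≤ length P × CTBorderPeriod P p
      × (LeftmostMinAt P 1 ⊎ LeftmostMinAt P (length P))) →
    LeftmostMinAt (P [ 1 ⋯ length P ∸ p ]) 1 →
    (i : ℕ) → 1 ≤ i → i ≤ length P / p →
    LeftmostMinAt (P [ (i ∸ 1) * p + 1 ⋯ length P ]) 1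
lemma15 O P p p<m/2 (_ , _ , border , minAtAnEnd) prefix[1] (suc k) _ i≤m/p =
  subst (λ Z → LeftmostMinAt Z 1) (sym (suffix-slice≡drop P (k * p)))
    (headIsMin⇒leftmostMinAt-1 (suffixMinAt-multiples P p border P[1] k kp<m))
  where
    open Strings O
    open SuffixMinima O
    m : ℕ
    m = length P

    p+1<m : suc p < m
    p+1<m = ≤-trans (s≤s (s≤s (m≤m*n p 2))) (≤-trans (*-monoˡ-≤ 2 p<m/2) (m/n*n≤m m 2))

    P[1] : HeadIsMin P
    P[1] = headIsMin-of-ctBlockPeriod P p border p+1<m prefix[1] minAtAnEnd

    kp<m : k * p < m
    kp<m = <-≤-trans (m<n+m (k * p) (>-nonZero⁻¹ p)) (≤-trans (*-monoˡ-≤ p i≤m/p) (m/n*n≤m m p))
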